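{- Let $\boldsymbol{Z}=\{z_{i,j}\in\mathbb{F}^2: i,j\in\mathbb{N}\}$ be a node set, let $m,n\in\mathbb{N}$, let $(i_0,j_0)\preceq(m,n)$ with $(i_0,j_0)\neq(m,n)$, let $z^*_{i_0,j_0}\in\mathbb{F}^2$, and let $\boldsymbol{Z}^*$ be the node set obtained from $\boldsymbol{Z}$ by replacing $z_{i_0,j_0}$ with $z^*_{i_0,j_0}$ (all other nodes unchanged). Then $$\tilde g_{m,n}((x,y);\boldsymbol{Z}^*)=\tilde g_{m,n}((x,y);\boldsymbol{Z})-\binom{m}{i_0}\binom{n}{j_0}\,\tilde g_{m-i_0,n-j_0}(z^*_{i_0,j_0};\boldsymbol{L}^{i_0}\boldsymbol{D}^{j_0}\boldsymbol{Z})\,\tilde g_{i_0,j_0}((x,y);\boldsymbol{Z}),$$ where $\boldsymbol{L}^{i_0}\boldsymbol{D}^{j_0}\boldsymbol{Z}=\{w_{a,b}=z_{a+i_0,b+j_0}: a,b\in\mathbb{N}\}$ and $\tilde g_{m-i_0,n-j_0}(z^*_{i_0,j_0};\cdot)$ denotes evaluation of the polynomial at $(x,y)=z^*_{i_0,j_0}$.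
   Context: $\mathbb{F}$ is a field of characteristic zero. For $p\in\mathbb{F}[x,y]$, $\Delta_x p(x,y)=p(x,y)-p(x-1,y)$ and $\Delta_y p(x,y)=p(x,y)-p(x,y-1)$. For $z\in\mathbb{F}^2$, $\varepsilon(z)$ denotes evaluation at $(x,y)=z$. Write $(i,j)\preceq(m,n)$ if $i\le m$ and $j\le n$. $\Pi^2_{m,n}$ is the space of polynomials of degree at most $m$ in $x$ and at most $n$ in $y$. For a node set $\boldsymbol{W}=\{w_{i,j}\}$ and $m,n\in\mathbb{N}$, $\tilde g_{m,n}((x,y);\boldsymbol{W})$ is the unique polynomial in $\Pi^2_{m,n}$ with $\varepsilon(w_{i,j})\Delta_x^i\Delta_y^j\tilde g_{m,n}((x,y);\boldsymbol{W})=m!\,n!\,\delta_{m,i}\delta_{n,j}$ for all $(i,j)\preceq(m,n)$. -}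

module Defs where

open import Level using (Level; _⊔_)
open import Data.Nat as ℕ using (ℕ; zero; suc; _≟_)
open import Data.Product using (_×_; _,_; proj₁; proj₂; Σ)
open import Data.Sum using (_⊎_)
open import Data.Bool using (Bool; true; false; if_then_else_; _∧_)
open import Data.Nat.Combinatorics using (_C_)
open import Data.Nat using (_!)
open import Relation.Nullary using (¬_)
open import Relation.Nullary.Decidable using (⌊_⌋)
open import Algebra.Bundles using (CommutativeRing)

record Field (c ℓ : Level) : Set (Level.suc (c ⊔ ℓ)) where
  field
    commutativeRing : CommutativeRing c ℓ
  open CommutativeRing commutativeRing public
  field
    0≉1     : ¬ (0# ≈ 1#)
    inverse : ∀ x → ¬ (x ≈ 0#) → Σ Carrier (λ y → x * y ≈ 1#)

module _ {c ℓ : Level} (F : Field c ℓ) where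
  open Field F using (Carrier; _≈_; _+_; _*_; _-_; 0#; 1#)

  ℕ→F : ℕ → Carrier
  ℕ→F zero    = 0#
  ℕ→F (suc n) = 1# + ℕ→F n

  CharZero : Set ℓ
  CharZero = ∀ n → ¬ (ℕ→F (suc n) ≈ 0#)

  pow : Carrier → ℕ → Carrier
  pow a zero    = 1#
  pow a (suc k) = a * pow a k

  sumTo : ℕ → (ℕ → Carrier) → Carrier
  sumTo zero    f = f zero
  sumTo (suc n) f = sumTo n f + f (suc n)

  Point : Set c
  Point = Carrier × Carrier

  -- bivariate polynomials as coefficient arrays: p i j is the coefficient of x^i y^j
  Poly : Set c
  Poly = ℕ → ℕ → Carrier

  InΠ : ℕ → ℕ → Poly → Set ℓ
  InΠ m n p = ∀ i j → (m ℕ.< i ⊎ n ℕ.< j) → p i j ≈ 0#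

  eval : ℕ → ℕ → Poly → Point → Carrier
  eval m n p (a , b) = sumTo m (λ i → sumTo n (λ j → p i j * (pow a i * pow b j)))

  Δx : (Point → Carrier) → Point → Carrier
  Δx f (a , b) = f (a , b) - f (a - 1# , b)

  Δy : (Point → Carrier) → Point → Carrier
  Δy f (a , b) = f (a , b) - f (a , b - 1#)

  iter : ℕ → ((Point → Carrier) → Point → Carrier) → (Point → Carrier) → Point → Carrier
  iter zero    D f = f
  iter (suc k) D f = D (iter k D f)

  NodeSet : Set c
  NodeSet = ℕ → ℕ → Point

  rhs : ℕ → ℕ → ℕ → ℕ → Carrier
  rhs m n i j = if ⌊ m ≟ i ⌋ ∧ ⌊ n ≟ j ⌋ then ℕ→F (m ! ℕ.* n !) else 0#

  -- G is the polynomial g̃_{m,n}((x,y); W): G ∈ Π²_{m,n} and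
  -- ε(w_{i,j}) Δx^i Δy^j G = m! n! δ_{m,i} δ_{n,j} for all (i,j) ⪯ (m,n).
  IsGTilde : ℕ → ℕ → NodeSet → Poly → Set ℓ
  IsGTilde m n W G =
    InΠ m n G ×
    (∀ i j → i ℕ.≤ m → j ℕ.≤ n →
       iter i Δx (iter j Δy (eval m n G)) (W i j) ≈ rhs m n i j)

  replace : NodeSet → ℕ → ℕ → Point → NodeSet
  replace Z i0 j0 z* i j = if ⌊ i ≟ i0 ⌋ ∧ ⌊ j ≟ j0 ⌋ then z* else Z i j

  shiftLD : ℕ → ℕ → NodeSet → NodeSet
  shiftLD i0 j0 Z a b = Z (a ℕ.+ i0) (b ℕ.+ j0)

module Submission where

-- A polynomial p ∈ Π²_{m,n} is determined by its data ε(w_{i,j}) Δx^i Δy^j p, (i,j) ⪯ (m,n): Δx lowers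
-- the x-degree and multiplies the leading x-coefficients by the degree, which is invertible in
-- characteristic zero, so by induction vanishing data force vanishing coefficients. This uniqueness,
-- applied to Δx^{i0} Δy^{j0} g̃_{m,n}(·; Z) ∈ Π²_{m-i0,n-j0}, identifies it with m!n!/((m-i0)!(n-j0)!)
-- g̃_{m-i0,n-j0}(·; L^{i0} D^{j0} Z), since both have the same data at the shifted nodes. The right-hand
-- side of the theorem therefore has the data of g̃_{m,n}(·; Z*): at the nodes other than z*_{i0,j0} the
-- data of g̃_{i0,j0}(·; Z) vanish, and at z*_{i0,j0} the correction term cancels the value of
-- Δx^{i0} Δy^{j0} g̃_{m,n}(·; Z), because Δx^{i0} Δy^{j0} g̃_{i0,j0}(·; Z) is the constant i0! j0!.

open import Defs
open import Level using (Level; _⊔_)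
open import Algebra.Bundles using (CommutativeRing)
open import Algebra.Solver.Ring.AlmostCommutativeRing using (fromCommutativeRing; _-Raw-AlmostCommutative⟶_)
import Algebra.Solver.Ring as RingSolver
open import Data.Empty using (⊥-elim)
open import Data.Integer as ℤ using (ℤ; +_; -[1+_]; _⊖_; _◃_; sign; ∣_∣)
import Data.Integer.Properties as ℤ
open import Data.Maybe using (Maybe; just; nothing)
open import Data.Nat as ℕ using (ℕ; zero; suc; _≤_; _<_; _∸_; z≤n; s≤s; _≤?_; _≟_; _!)
import Data.Nat.Properties as ℕ
open import Data.Nat.Properties using (_!*_!≢0)
open import Data.Nat.Combinatorics using (_C_; nCk≡n!/k![n-k]!; k![n∸k]!∣n!)
open import Data.Nat.DivMod using (m/n*n≡m)
open import Data.Nat.Tactic.RingSolver using (solve-∀)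
open import Data.Product using (Σ; _×_; _,_; proj₁; proj₂)
open import Data.Sign as Sign using (Sign)
open import Data.Sum as Sum using (_⊎_; inj₁; inj₂; [_,_]′)
open import Relation.Nullary using (¬_; yes; no; Dec)
open import Relation.Binary.PropositionalEquality as ≡ using (_≡_)

nCk*k!*[n∸k]!≡n! : ∀ {n k} → k ≤ n → (n C k) ℕ.* (k ! ℕ.* (n ∸ k) !) ≡ n !
nCk*k!*[n∸k]!≡n! {n} {k} k≤n =
  ≡.trans (≡.cong (ℕ._* (k ! ℕ.* (n ∸ k) !)) (nCk≡n!/k![n-k]! k≤n)) (m/n*n≡m (k![n∸k]!∣n! k≤n))
  where instance _ = k !* (n ∸ k) !≢0

-- m!/(m-i)! · n!/(n-j)!, the factor by which Δx^i Δy^j scales g̃_{m,n}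
Δ-scale : ℕ → ℕ → ℕ → ℕ → ℕ
Δ-scale m n i j = ((m C i) ℕ.* (n C j)) ℕ.* (i ! ℕ.* j !)

m!*n!≡Δ-scale*[m∸i]!*[n∸j]! : ∀ {m n i j} → i ≤ m → j ≤ n →
  m ! ℕ.* n ! ≡ Δ-scale m n i j ℕ.* ((m ∸ i) ! ℕ.* (n ∸ j) !)
m!*n!≡Δ-scale*[m∸i]!*[n∸j]! {m} {n} {i} {j} i≤m j≤n = begin
  m ! ℕ.* n !
    ≡⟨ ≡.cong₂ ℕ._*_ (nCk*k!*[n∸k]!≡n! i≤m) (nCk*k!*[n∸k]!≡n! j≤n) ⟨
  ((m C i) ℕ.* (i ! ℕ.* (m ∸ i) !)) ℕ.* ((n C j) ℕ.* (j ! ℕ.* (n ∸ j) !))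
    ≡⟨ rearrange (m C i) (i !) ((m ∸ i) !) (n C j) (j !) ((n ∸ j) !) ⟩
  Δ-scale m n i j ℕ.* ((m ∸ i) ! ℕ.* (n ∸ j) !) ∎
  where
  open ≡.≡-Reasoning
  rearrange : ∀ a b c d e f →
    (a ℕ.* (b ℕ.* c)) ℕ.* (d ℕ.* (e ℕ.* f)) ≡ ((a ℕ.* d) ℕ.* (b ℕ.* e)) ℕ.* (c ℕ.* f)
  rearrange = solve-∀

inBox? : ∀ i j m n → (i ≤ m × j ≤ n) ⊎ (m < i ⊎ n < j)
inBox? i j m n with i ≤? m | j ≤? n
... | yes i≤m | yes j≤n = inj₁ (i≤m , j≤n)
... | no  i≰m | _       = inj₂ (inj₁ (ℕ.≰⇒> i≰m))
... | yes _   | no  j≰n = inj₂ (inj₂ (ℕ.≰⇒> j≰n))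

-- Algebra.Solver.Ring needs a coefficient ring with decidable equality; ℤ maps into every commutative ring.
module IntegerCoefficients {c ℓ : Level} (R : CommutativeRing c ℓ) where
  open CommutativeRing R
  open import Algebra.Properties.Ring ring
    using (-‿distribˡ-*; -‿distribʳ-*; -‿involutive; -0#≈0#; -‿+-comm)
  open import Algebra.Properties.Semiring.Mult.TCOptimised semiring
    using (1+×; ×-homo-+; ×1-homo-*) renaming (_×_ to _·_)
  open import Relation.Binary.Reasoning.Setoid setoid

  signed : Sign → Carrier → Carrier
  signed Sign.+ x = x
  signed Sign.- x = - x

  ⟦_⟧ : ℤ → Carrier
  ⟦ + n ⟧      = n · 1#
  ⟦ -[1+ n ] ⟧ = - (suc n · 1#)

  signed-cong : ∀ s {x y} → x ≈ y → signed s x ≈ signed s y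
  signed-cong Sign.+ x≈y = x≈y
  signed-cong Sign.- x≈y = -‿cong x≈y

  signed-* : ∀ s t x y → signed (s Sign.* t) (x * y) ≈ signed s x * signed t y
  signed-* Sign.+ Sign.+ x y = refl
  signed-* Sign.+ Sign.- x y = -‿distribʳ-* x y
  signed-* Sign.- Sign.+ x y = -‿distribˡ-* x y
  signed-* Sign.- Sign.- x y = begin
    x * y         ≈⟨ -‿involutive (x * y) ⟨
    - - (x * y)   ≈⟨ -‿cong (-‿distribˡ-* x y) ⟩
    - (- x * y)   ≈⟨ -‿distribʳ-* (- x) y ⟩
    - x * - y     ∎

  ⟦⟧-signed : ∀ i → ⟦ i ⟧ ≈ signed (sign i) (∣ i ∣ · 1#)
  ⟦⟧-signed (+ n)    = refl
  ⟦⟧-signed -[1+ n ] = refl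

  ⟦◃⟧ : ∀ s n → ⟦ s ◃ n ⟧ ≈ signed s (n · 1#)
  ⟦◃⟧ Sign.+ zero    = refl
  ⟦◃⟧ Sign.- zero    = sym -0#≈0#
  ⟦◃⟧ Sign.+ (suc n) = refl
  ⟦◃⟧ Sign.- (suc n) = refl

  ⟦⊖⟧ : ∀ m n → ⟦ m ⊖ n ⟧ ≈ m · 1# - n · 1#
  ⟦⊖⟧ m       zero    = sym (trans (+-congˡ -0#≈0#) (+-identityʳ _))
  ⟦⊖⟧ zero    (suc n) = sym (+-identityˡ _)
  ⟦⊖⟧ (suc m) (suc n) = begin
    ⟦ suc m ⊖ suc n ⟧        ≡⟨ ≡.cong ⟦_⟧ (ℤ.[1+m]⊖[1+n]≡m⊖n m n) ⟩
    ⟦ m ⊖ n ⟧                ≈⟨ ⟦⊖⟧ m n ⟩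
    M - N                    ≈⟨ +-identityˡ (M - N) ⟨
    0# + (M - N)             ≈⟨ +-congʳ (-‿inverseʳ 1#) ⟨
    (1# - 1#) + (M - N)      ≈⟨ +-assoc 1# (- 1#) (M - N) ⟩
    1# + (- 1# + (M - N))    ≈⟨ +-congˡ (+-assoc (- 1#) M (- N)) ⟨
    1# + ((- 1# + M) - N)    ≈⟨ +-congˡ (+-congʳ (+-comm (- 1#) M)) ⟩
    1# + ((M - 1#) - N)      ≈⟨ +-congˡ (+-assoc M (- 1#) (- N)) ⟩
    1# + (M + (- 1# - N))    ≈⟨ +-congˡ (+-congˡ (-‿+-comm 1# N)) ⟩
    1# + (M - (1# + N))      ≈⟨ +-assoc 1# M (- (1# + N)) ⟨
    (1# + M) - (1# + N)      ≈⟨ +-cong (1+× m 1#) (-‿cong (1+× n 1#)) ⟨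
    suc m · 1# - suc n · 1#  ∎
    where M = m · 1#; N = n · 1#

  ⟦+⟧ : ∀ i j → ⟦ i ℤ.+ j ⟧ ≈ ⟦ i ⟧ + ⟦ j ⟧
  ⟦+⟧ (+ m)    (+ n)    = ×-homo-+ 1# m n
  ⟦+⟧ (+ m)    -[1+ n ] = ⟦⊖⟧ m (suc n)
  ⟦+⟧ -[1+ m ] (+ n)    = trans (⟦⊖⟧ n (suc m)) (+-comm _ _)
  ⟦+⟧ -[1+ m ] -[1+ n ] = begin
    - (suc (suc m ℕ.+ n) · 1#)   ≡⟨ ≡.cong (λ k → - (k · 1#)) (ℕ.+-suc (suc m) n) ⟨
    - ((suc m ℕ.+ suc n) · 1#)   ≈⟨ -‿cong (×-homo-+ 1# (suc m) (suc n)) ⟩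
    - (suc m · 1# + suc n · 1#)  ≈⟨ -‿+-comm (suc m · 1#) (suc n · 1#) ⟨
    - (suc m · 1#) - suc n · 1#  ∎

  ⟦*⟧ : ∀ i j → ⟦ i ℤ.* j ⟧ ≈ ⟦ i ⟧ * ⟦ j ⟧
  ⟦*⟧ i j = begin
    ⟦ s ◃ ∣ i ∣ ℕ.* ∣ j ∣ ⟧                                 ≈⟨ ⟦◃⟧ s (∣ i ∣ ℕ.* ∣ j ∣) ⟩
    signed s ((∣ i ∣ ℕ.* ∣ j ∣) · 1#)                       ≈⟨ signed-cong s (×1-homo-* ∣ i ∣ ∣ j ∣) ⟩
    signed s (∣ i ∣ · 1# * ∣ j ∣ · 1#)                      ≈⟨ signed-* (sign i) (sign j) _ _ ⟩
    signed (sign i) (∣ i ∣ · 1#) * signed (sign j) (∣ j ∣ · 1#)  ≈⟨ *-cong (⟦⟧-signed i) (⟦⟧-signed j) ⟨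
    ⟦ i ⟧ * ⟦ j ⟧                                           ∎
    where s = sign i Sign.* sign j

  ⟦-⟧ : ∀ i → ⟦ ℤ.- i ⟧ ≈ - ⟦ i ⟧
  ⟦-⟧ (+ zero)  = sym -0#≈0#
  ⟦-⟧ (+ suc n) = refl
  ⟦-⟧ -[1+ n ]  = sym (-‿involutive _)

  homomorphism : ℤ.+-*-rawRing -Raw-AlmostCommutative⟶ fromCommutativeRing R
  homomorphism = record
    { ⟦_⟧ = ⟦_⟧ ; +-homo = ⟦+⟧ ; *-homo = ⟦*⟧ ; -‿homo = ⟦-⟧ ; 0-homo = refl ; 1-homo = refl }

  _≟⟦⟧_ : ∀ i j → Maybe (⟦ i ⟧ ≈ ⟦ j ⟧)
  i ≟⟦⟧ j with i ℤ.≟ j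
  ... | yes ≡.refl = just refl
  ... | no _       = nothing

  open RingSolver ℤ.+-*-rawRing (fromCommutativeRing R) homomorphism _≟⟦⟧_ public
    using (solve; _:=_; _:+_; _:*_; _:-_; con)

module Interpolation {c ℓ : Level} (F : Field c ℓ) where
  open Field F
  open IntegerCoefficients commutativeRing
  open import Algebra.Properties.Ring ring using (x∙y⁻¹≈ε⇒x≈y; [y-z]x≈yx-zx; x[y-z]≈xy-xz)
  open import Algebra.Properties.Semiring.Mult semiring using (×1-homo-*) renaming (_×_ to _·ᵤ_)
  open import Relation.Binary.Reasoning.Setoid setoid

  Fun : Set c
  Fun = Point F → Carrier

  infix 4 _≗_
  _≗_ : Fun → Fun → Set (c ⊔ ℓ)
  f ≗ g = ∀ p → f p ≈ g p

  sumTo-cong : ∀ n {f g : ℕ → Carrier} → (∀ i → i ≤ n → f i ≈ g i) → sumTo F n f ≈ sumTo F n g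
  sumTo-cong zero    f≈g = f≈g 0 z≤n
  sumTo-cong (suc n) f≈g =
    +-cong (sumTo-cong n (λ i i≤n → f≈g i (ℕ.m≤n⇒m≤1+n i≤n))) (f≈g (suc n) ℕ.≤-refl)

  sumTo-zero : ∀ n {f : ℕ → Carrier} → (∀ i → i ≤ n → f i ≈ 0#) → sumTo F n f ≈ 0#
  sumTo-zero zero    f≈0 = f≈0 0 z≤n
  sumTo-zero (suc n) f≈0 = trans
    (+-cong (sumTo-zero n (λ i i≤n → f≈0 i (ℕ.m≤n⇒m≤1+n i≤n))) (f≈0 (suc n) ℕ.≤-refl)) (+-identityʳ 0#)

  sumTo-+ : ∀ n (f g : ℕ → Carrier) → sumTo F n (λ i → f i + g i) ≈ sumTo F n f + sumTo F n g
  sumTo-+ zero    f g = refl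
  sumTo-+ (suc n) f g = trans (+-congʳ (sumTo-+ n f g))
    (solve 4 (λ a b x y → (a :+ b) :+ (x :+ y) := (a :+ x) :+ (b :+ y)) refl _ _ _ _)

  sumTo-- : ∀ n (f g : ℕ → Carrier) → sumTo F n (λ i → f i - g i) ≈ sumTo F n f - sumTo F n g
  sumTo-- zero    f g = refl
  sumTo-- (suc n) f g = trans (+-congʳ (sumTo-- n f g))
    (solve 4 (λ a b x y → (a :- b) :+ (x :- y) := (a :+ x) :- (b :+ y)) refl _ _ _ _)

  sumTo-*ˡ : ∀ n k (f : ℕ → Carrier) → k * sumTo F n f ≈ sumTo F n (λ i → k * f i)
  sumTo-*ˡ zero    k f = refl
  sumTo-*ˡ (suc n) k f = trans (distribˡ k _ _) (+-congʳ (sumTo-*ˡ n k f))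

  sumTo-*ʳ : ∀ n k (f : ℕ → Carrier) → sumTo F n f * k ≈ sumTo F n (λ i → f i * k)
  sumTo-*ʳ n k f = trans (*-comm _ k) (trans (sumTo-*ˡ n k f) (sumTo-cong n (λ i _ → *-comm k (f i))))

  sumTo-swap : ∀ m n (f : ℕ → ℕ → Carrier) →
    sumTo F m (λ i → sumTo F n (f i)) ≈ sumTo F n (λ j → sumTo F m (λ i → f i j))
  sumTo-swap zero    n f = refl
  sumTo-swap (suc m) n f = trans (+-congʳ (sumTo-swap m n f)) (sym (sumTo-+ n _ _))

  eval-cong : ∀ m n {q r : Poly F} → (∀ i j → i ≤ m → j ≤ n → q i j ≈ r i j) → eval F m n q ≗ eval F m n r
  eval-cong m n q≈r (a , b) = sumTo-cong m (λ i i≤m → sumTo-cong n (λ j j≤n → *-congʳ (q≈r i j i≤m j≤n)))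

  eval-zero : ∀ m n {q : Poly F} → (∀ i j → i ≤ m → j ≤ n → q i j ≈ 0#) → eval F m n q ≗ λ _ → 0#
  eval-zero m n q≈0 (a , b) =
    sumTo-zero m (λ i i≤m → sumTo-zero n (λ j j≤n → trans (*-congʳ (q≈0 i j i≤m j≤n)) (zeroˡ _)))

  eval-+ : ∀ m n (q r : Poly F) → eval F m n (λ i j → q i j + r i j) ≗ λ p → eval F m n q p + eval F m n r p
  eval-+ m n q r (a , b) = trans
    (sumTo-cong m (λ i _ → trans (sumTo-cong n (λ j _ → distribʳ _ (q i j) (r i j))) (sumTo-+ n _ _)))
    (sumTo-+ m _ _)

  eval-- : ∀ m n (q r : Poly F) → eval F m n (λ i j → q i j - r i j) ≗ λ p → eval F m n q p - eval F m n r p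
  eval-- m n q r (a , b) = trans
    (sumTo-cong m (λ i _ → trans (sumTo-cong n (λ j _ → [y-z]x≈yx-zx _ (q i j) (r i j))) (sumTo-- n _ _)))
    (sumTo-- m _ _)

  eval-*ˡ : ∀ m n k (q : Poly F) → eval F m n (λ i j → k * q i j) ≗ λ p → k * eval F m n q p
  eval-*ˡ m n k q (a , b) = sym (trans (sumTo-*ˡ m k _) (sumTo-cong m (λ i _ →
    trans (sumTo-*ˡ n k _) (sumTo-cong n (λ j _ → sym (*-assoc k (q i j) _))))))

  eval-combination : ∀ m n k (q r : Poly F) →
    eval F m n (λ i j → q i j - k * r i j) ≗ λ p → eval F m n q p - k * eval F m n r p
  eval-combination m n k q r p = trans (eval-- m n q _ p) (+-congˡ (-‿cong (eval-*ˡ m n k r p)))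

  eval-dropRow : ∀ m n {q : Poly F} → (∀ j → j ≤ n → q (suc m) j ≈ 0#) → eval F (suc m) n q ≗ eval F m n q
  eval-dropRow m n q≈0 (a , b) =
    trans (+-congˡ (sumTo-zero n (λ j j≤n → trans (*-congʳ (q≈0 j j≤n)) (zeroˡ _)))) (+-identityʳ _)

  eval-dropColumn : ∀ m n {q : Poly F} → (∀ i → i ≤ m → q i (suc n) ≈ 0#) → eval F m (suc n) q ≗ eval F m n q
  eval-dropColumn m n q≈0 (a , b) = sumTo-cong m (λ i i≤m →
    trans (+-congˡ (trans (*-congʳ (q≈0 i i≤m)) (zeroˡ _))) (+-identityʳ _))

  eval-InΠ : ∀ {a b} m n {q : Poly F} → InΠ F a b q → a ≤ m → b ≤ n → eval F m n q ≗ eval F a b q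
  eval-InΠ {a} {b} m n {q} q∈Π a≤m b≤n p = trans (shrinkRows m a≤m) (shrinkColumns n b≤n)
    where
    shrinkColumns : ∀ n → b ≤ n → eval F a n q p ≈ eval F a b q p
    shrinkColumns n b≤n with ℕ.m≤n⇒m<n∨m≡n b≤n
    ... | inj₂ ≡.refl = refl
    shrinkColumns (suc n) _ | inj₁ (s≤s b≤n) =
      trans (eval-dropColumn a n (λ i _ → q∈Π i (suc n) (inj₂ (s≤s b≤n))) p) (shrinkColumns n b≤n)
    shrinkRows : ∀ m → a ≤ m → eval F m n q p ≈ eval F a n q p
    shrinkRows m a≤m with ℕ.m≤n⇒m<n∨m≡n a≤m
    ... | inj₂ ≡.refl = refl
    shrinkRows (suc m) _ | inj₁ (s≤s a≤m) =
      trans (eval-dropRow m n (λ j _ → q∈Π (suc m) j (inj₁ (s≤s a≤m))) p) (shrinkRows m a≤m)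

  transpose : Poly F → Poly F
  transpose q i j = q j i

  eval-transpose : ∀ m n (q : Poly F) a b → eval F m n q (a , b) ≈ eval F n m (transpose q) (b , a)
  eval-transpose m n q a b =
    trans (sumTo-swap m n _) (sumTo-cong n (λ j _ → sumTo-cong m (λ i _ → *-congˡ (*-comm _ _))))

  zeroPoly : Poly F
  zeroPoly _ _ = 0#

  record Linear (D : Fun → Fun) : Set (c ⊔ ℓ) where
    field
      cong        : ∀ {f g} → f ≗ g → D f ≗ D g
      additive    : ∀ f g → D (λ p → f p + g p) ≗ λ p → D f p + D g p
      subtractive : ∀ f g → D (λ p → f p - g p) ≗ λ p → D f p - D g p
      homogeneous : ∀ k f → D (λ p → k * f p) ≗ λ p → k * D f p

    vanishing : ∀ {f} → f ≗ (λ _ → 0#) → D f ≗ (λ _ → 0#)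
    vanishing {f} f≈0 p = begin
      D f p                  ≈⟨ cong (λ q → trans (f≈0 q) (sym (zeroˡ 0#))) p ⟩
      D (λ _ → 0# * 0#) p    ≈⟨ homogeneous 0# (λ _ → 0#) p ⟩
      0# * D (λ _ → 0#) p    ≈⟨ zeroˡ _ ⟩
      0#                     ∎

    combination : ∀ k f g → D (λ p → f p - k * g p) ≗ λ p → D f p - k * D g p
    combination k f g p = trans (subtractive f _ p) (+-congˡ (-‿cong (homogeneous k g p)))

  open Linear

  id-linear : Linear (λ f → f)
  id-linear = record
    { cong        = λ f≈g → f≈g
    ; additive    = λ _ _ _ → refl
    ; subtractive = λ _ _ _ → refl
    ; homogeneous = λ _ _ _ → refl
    }

  ∘-linear : ∀ {D E : Fun → Fun} → Linear D → Linear E → Linear (λ f → D (E f))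
  ∘-linear {D} {E} D-lin E-lin = record
    { cong        = λ f≈g → cong D-lin (cong E-lin f≈g)
    ; additive    = λ f g p → trans (cong D-lin (additive E-lin f g) p) (additive D-lin (E f) (E g) p)
    ; subtractive = λ f g p → trans (cong D-lin (subtractive E-lin f g) p) (subtractive D-lin (E f) (E g) p)
    ; homogeneous = λ k f p → trans (cong D-lin (homogeneous E-lin k f) p) (homogeneous D-lin k (E f) p)
    }

  iter-linear : ∀ k {D : Fun → Fun} → Linear D → Linear (iter F k D)
  iter-linear zero    D-lin = id-linear
  iter-linear (suc k) D-lin = ∘-linear D-lin (iter-linear k D-lin)

  difference : (Point F → Point F) → Fun → Fun
  difference s f p = f p - f (s p)

  difference-linear : ∀ s → Linear (difference s)
  difference-linear s = record
    { cong        = λ f≈g p → +-cong (f≈g p) (-‿cong (f≈g (s p)))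
    ; additive    = λ f g p → solve 4 (λ x y x′ y′ → (x :+ y) :- (x′ :+ y′) := (x :- x′) :+ (y :- y′))
                                      refl _ _ _ _
    ; subtractive = λ f g p → solve 4 (λ x y x′ y′ → (x :- y) :- (x′ :- y′) := (x :- x′) :- (y :- y′))
                                      refl _ _ _ _
    ; homogeneous = λ k f p → sym (x[y-z]≈xy-xz k (f p) (f (s p)))
    }

  difference-comm : ∀ s t → (∀ p → s (t p) ≡ t (s p)) → ∀ f →
    difference s (difference t f) ≗ difference t (difference s f)
  difference-comm s t st≡ts f p rewrite st≡ts p =
    solve 4 (λ x y z w → (x :- y) :- (z :- w) := (x :- z) :- (y :- w)) refl _ _ _ _

  Δx-linear : Linear (Δx F)
  Δx-linear = difference-linear (λ (a , b) → a - 1# , b)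

  Δy-linear : Linear (Δy F)
  Δy-linear = difference-linear (λ (a , b) → a , b - 1#)

  Δx-Δy-comm : ∀ f → Δx F (Δy F f) ≗ Δy F (Δx F f)
  Δx-Δy-comm = difference-comm (λ (a , b) → a - 1# , b) (λ (a , b) → a , b - 1#) (λ _ → ≡.refl)

  iter-suc : ∀ k D (f : Fun) → iter F k D (D f) ≡ iter F (suc k) D f
  iter-suc zero    D f = ≡.refl
  iter-suc (suc k) D f = ≡.cong D (iter-suc k D f)

  iter-+ : ∀ a b D (f : Fun) → iter F a D (iter F b D f) ≡ iter F (a ℕ.+ b) D f
  iter-+ zero    b D f = ≡.refl
  iter-+ (suc a) b D f = ≡.cong D (iter-+ a b D f)

  iter-comm : ∀ k {D E : Fun → Fun} → Linear E → (∀ f → D (E f) ≗ E (D f)) →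
    ∀ f → iter F k E (D f) ≗ D (iter F k E f)
  iter-comm zero    E-lin DE≈ED f p = refl
  iter-comm (suc k) E-lin DE≈ED f p = trans (cong E-lin (iter-comm k E-lin DE≈ED f) p) (sym (DE≈ED _ p))

  iter-iter-comm : ∀ i k {D E : Fun → Fun} → Linear D → Linear E → (∀ f → D (E f) ≗ E (D f)) →
    ∀ f → iter F k E (iter F i D f) ≗ iter F i D (iter F k E f)
  iter-iter-comm zero    k D-lin E-lin DE≈ED f p = refl
  iter-iter-comm (suc i) k D-lin E-lin DE≈ED f p =
    trans (iter-comm k E-lin DE≈ED (iter F i _ f) p) (cong D-lin (iter-iter-comm i k D-lin E-lin DE≈ED f) p)

  Δ[_,_] : ℕ → ℕ → Fun → Fun
  Δ[ i , j ] f = iter F i (Δx F) (iter F j (Δy F) f)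

  Δ-linear : ∀ i j → Linear Δ[ i , j ]
  Δ-linear i j = ∘-linear (iter-linear i Δx-linear) (iter-linear j Δy-linear)

  Δ-+ : ∀ a b i j f → Δ[ a , b ] (Δ[ i , j ] f) ≗ Δ[ a ℕ.+ i , b ℕ.+ j ] f
  Δ-+ a b i j f p = begin
    iter F a (Δx F) (iter F b (Δy F) (iter F i (Δx F) (iter F j (Δy F) f))) p
      ≈⟨ cong (iter-linear a Δx-linear) (iter-iter-comm i b Δx-linear Δy-linear Δx-Δy-comm _) p ⟩
    iter F a (Δx F) (iter F i (Δx F) (iter F b (Δy F) (iter F j (Δy F) f))) p
      ≡⟨ ≡.cong-app (≡.trans (iter-+ a i _ _) (≡.cong (iter F (a ℕ.+ i) (Δx F)) (iter-+ b j _ f))) p ⟩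
    Δ[ a ℕ.+ i , b ℕ.+ j ] f p ∎

  Δ-Δx : ∀ i j f → Δ[ i , j ] (Δx F f) ≗ Δ[ suc i , j ] f
  Δ-Δx i j f p =
    trans (Δ-+ i j 1 0 f p) (reflexive (≡.cong₂ (λ a b → Δ[ a , b ] f p) (ℕ.+-comm i 1) (ℕ.+-identityʳ j)))

  eval₁ : ℕ → (ℕ → Carrier) → Carrier → Carrier
  eval₁ k e a = sumTo F k (λ i → e i * pow F a i)

  shiftCoefficients : (ℕ → Carrier) → ℕ → Carrier
  shiftCoefficients e zero    = 0#
  shiftCoefficients e (suc i) = e i

  eval₁-*x : ∀ k e a → a * eval₁ k e a ≈ eval₁ (suc k) (shiftCoefficients e) a
  eval₁-*x zero    e a =
    solve 2 (λ a x → a :* (x :* con (+ 1)) := con (+ 0) :* con (+ 1) :+ x :* (a :* con (+ 1))) refl a (e 0)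
  eval₁-*x (suc k) e a = trans
    (solve 4 (λ a P x y → a :* (P :+ x :* y) := a :* P :+ x :* (a :* y)) refl a _ _ _) (+-congʳ (eval₁-*x k e a))

  eval₁-- : ∀ k e e′ a → eval₁ k (λ i → e i - e′ i) a ≈ eval₁ k e a - eval₁ k e′ a
  eval₁-- k e e′ a = trans (sumTo-cong k (λ i _ → [y-z]x≈yx-zx _ (e i) (e′ i))) (sumTo-- k _ _)

  powerDifference : ∀ k → Σ (ℕ → Carrier) λ e →
    (∀ a → pow F a (suc k) - pow F (a - 1#) (suc k) ≈ eval₁ k e a) × (e k ≈ ℕ→F F (suc k))
  powerDifference zero = (λ _ → 1#) ,
    (λ a → solve 1 (λ a → a :* con (+ 1) :- (a :- con (+ 1)) :* con (+ 1) := con (+ 1) :* con (+ 1)) refl a) ,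
    sym (+-identityʳ 1#)
  powerDifference (suc k) with powerDifference k
  ... | e , e-difference , e-leading =
    e′ , e′-difference , trans e′-top (trans (+-congʳ e-leading) (+-comm _ 1#))
    where
    e′ : ℕ → Carrier
    e′ i with i ≤? k
    ... | yes _ = shiftCoefficients e i - e i
    ... | no  _ = e k + 1#

    e′-low : ∀ i → i ≤ k → e′ i ≈ shiftCoefficients e i - e i
    e′-low i i≤k with i ≤? k
    ... | yes _   = refl
    ... | no  i≰k = ⊥-elim (i≰k i≤k)

    e′-top : e′ (suc k) ≈ e k + 1#
    e′-top with suc k ≤? k
    ... | yes k<k = ⊥-elim (ℕ.<-irrefl ≡.refl k<k)
    ... | no  _   = refl

    -- a^{k+2} - (a-1)^{k+2} = a (a^{k+1} - (a-1)^{k+1}) + (a-1)^{k+1}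
    e′-difference : ∀ a → pow F a (suc (suc k)) - pow F (a - 1#) (suc (suc k)) ≈ eval₁ (suc k) e′ a
    e′-difference a = begin
      a * X - (a - 1#) * Y       ≈⟨ solve 3 (λ a X Y → a :* X :- (a :- con (+ 1)) :* Y
                                                      := a :* (X :- Y) :+ X :- (X :- Y)) refl a X Y ⟩
      a * (X - Y) + X - (X - Y)  ≈⟨ +-cong (+-congʳ (*-congˡ (e-difference a))) (-‿cong (e-difference a)) ⟩
      a * P + X - P              ≈⟨ +-congʳ (+-congʳ (eval₁-*x k e a)) ⟩
      (S + e k * X) + X - P      ≈⟨ solve 4 (λ S x X P → (S :+ x :* X) :+ X :- P
                                                      := (S :- P) :+ (x :+ con (+ 1)) :* X) refl S (e k) X P ⟩
      (S - P) + (e k + 1#) * X   ≈⟨ +-cong (sym S-P≈) (*-congʳ (sym e′-top)) ⟩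
      eval₁ (suc k) e′ a         ∎
      where
      X = pow F a (suc k)
      Y = pow F (a - 1#) (suc k)
      P = eval₁ k e a
      S = eval₁ k (shiftCoefficients e) a
      S-P≈ : eval₁ k e′ a ≈ S - P
      S-P≈ = trans (sumTo-cong k (λ i i≤k → *-congʳ (e′-low i i≤k))) (eval₁-- k (shiftCoefficients e) e a)

  -- eval F (suc m) n q unfolds to λ p → eval F m n q p + row (suc m) n q p.
  row : ℕ → ℕ → Poly F → Fun
  row i n q (a , b) = sumTo F n (λ j → q i j * (pow F a i * pow F b j))

  Δx-row : ∀ m n q → Δx F (row (suc m) n q) ≗ eval F m n (λ i j → proj₁ (powerDifference m) i * q (suc m) j)
  Δx-row m n q (a , b) = begin
    sumTo F n (λ j → q (suc m) j * (A * pow F b j)) - sumTo F n (λ j → q (suc m) j * (A′ * pow F b j))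
      ≈⟨ sumTo-- n _ _ ⟨
    sumTo F n (λ j → q (suc m) j * (A * pow F b j) - q (suc m) j * (A′ * pow F b j))
      ≈⟨ sumTo-cong n (λ j _ → trans
           (solve 4 (λ x A A′ y → x :* (A :* y) :- x :* (A′ :* y) := x :* ((A :- A′) :* y)) refl _ _ _ _)
           (*-congˡ (*-congʳ (proj₁ (proj₂ (powerDifference m)) a)))) ⟩
    sumTo F n (λ j → q (suc m) j * (eval₁ m e a * pow F b j))
      ≈⟨ sumTo-cong n (λ j _ → trans (*-congˡ (sumTo-*ʳ m _ _)) (trans (sumTo-*ˡ m _ _) (sumTo-cong m (λ i _ →
           solve 4 (λ x y z w → x :* ((y :* z) :* w) := (y :* x) :* (z :* w)) refl _ _ _ _)))) ⟩
    sumTo F n (λ j → sumTo F m (λ i → (e i * q (suc m) j) * (pow F a i * pow F b j)))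
      ≈⟨ sumTo-swap m n _ ⟨
    eval F m n (λ i j → e i * q (suc m) j) (a , b) ∎
    where
    e  = proj₁ (powerDifference m)
    A  = pow F a (suc m)
    A′ = pow F (a - 1#) (suc m)

  truncateRows : ℕ → Poly F → Poly F
  truncateRows k q i j with i ≤? k
  ... | yes _ = q i j
  ... | no  _ = 0#

  truncateRows-≤ : ∀ k q i j → i ≤ k → truncateRows k q i j ≈ q i j
  truncateRows-≤ k q i j i≤k with i ≤? k
  ... | yes _   = refl
  ... | no  i≰k = ⊥-elim (i≰k i≤k)

  truncateRows-> : ∀ k q j → truncateRows k q (suc k) j ≈ 0#
  truncateRows-> k q j with suc k ≤? k
  ... | yes k<k = ⊥-elim (ℕ.<-irrefl ≡.refl k<k)
  ... | no  _   = refl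

  eval-truncateRows : ∀ m n q → eval F (suc m) n (truncateRows m q) ≗ eval F m n q
  eval-truncateRows m n q p = trans (eval-dropRow m n (λ j _ → truncateRows-> m q j) p)
                                    (eval-cong m n (λ i j i≤m _ → truncateRows-≤ m q i j i≤m) p)

  Δx-eval₀ : ∀ n q → Δx F (eval F 0 n q) ≗ λ _ → 0#
  Δx-eval₀ n q (a , b) = -‿inverseʳ _

  Δy-eval₀ : ∀ m q → Δy F (eval F m 0 q) ≗ λ _ → 0#
  Δy-eval₀ m q (a , b) = -‿inverseʳ _

  record HasTopRow (m n : ℕ) (f : Fun) (top : ℕ → Carrier) : Set (c ⊔ ℓ) where
    field
      coefficients : Poly F
      ≗-eval       : f ≗ eval F m n coefficients
      topRow       : ∀ j → coefficients m j ≈ top j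

  record HasTopColumn (m n : ℕ) (f : Fun) (top : ℕ → Carrier) : Set (c ⊔ ℓ) where
    field
      coefficients : Poly F
      ≗-eval       : f ≗ eval F m n coefficients
      topColumn    : ∀ i → coefficients i n ≈ top i

  Δx-eval : ∀ m n q → HasTopRow m n (Δx F (eval F (suc m) n q)) (λ j → ℕ→F F (suc m) * q (suc m) j)
  Δx-eval-lowersDegree : ∀ m n q → HasTopRow m n (Δx F (eval F m n q)) (λ _ → 0#)

  Δx-eval m n q = record { coefficients = λ i j → q′ i j + r i j ; ≗-eval = Δx≈ ; topRow = leading }
    where
    open HasTopRow (Δx-eval-lowersDegree m n q) renaming (coefficients to q′; ≗-eval to Δx≈q′; topRow to q′-top)
    r : Poly F
    r i j = proj₁ (powerDifference m) i * q (suc m) j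
    Δx≈ : Δx F (eval F (suc m) n q) ≗ eval F m n (λ i j → q′ i j + r i j)
    Δx≈ p = begin
      Δx F (eval F (suc m) n q) p                        ≈⟨ additive Δx-linear (eval F m n q) (row (suc m) n q) p ⟩
      Δx F (eval F m n q) p + Δx F (row (suc m) n q) p  ≈⟨ +-cong (Δx≈q′ p) (Δx-row m n q p) ⟩
      eval F m n q′ p + eval F m n r p                  ≈⟨ eval-+ m n q′ r p ⟨
      eval F m n (λ i j → q′ i j + r i j) p             ∎
    leading : ∀ j → q′ m j + r m j ≈ ℕ→F F (suc m) * q (suc m) j
    leading j = trans (+-cong (q′-top j) (*-congʳ (proj₂ (proj₂ (powerDifference m))))) (+-identityˡ _)

  Δx-eval-lowersDegree zero n q = record
    { coefficients = zeroPoly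
    ; ≗-eval       = λ p → trans (Δx-eval₀ n q p) (sym (eval-zero 0 n (λ _ _ _ _ → refl) p))
    ; topRow       = λ _ → refl
    }
  Δx-eval-lowersDegree (suc m) n q = record
    { coefficients = truncateRows m q′
    ; ≗-eval       = λ p → trans (Δx≈ p) (sym (eval-truncateRows m n q′ p))
    ; topRow       = truncateRows-> m q′
    }
    where open HasTopRow (Δx-eval m n q) renaming (coefficients to q′; ≗-eval to Δx≈)

  Δy-eval : ∀ m n q → HasTopColumn m n (Δy F (eval F m (suc n) q)) (λ i → ℕ→F F (suc n) * q i (suc n))
  Δy-eval m n q = record { coefficients = transpose r ; ≗-eval = Δy≈ ; topColumn = leading }
    where
    open HasTopRow (Δx-eval n m (transpose q)) renaming (coefficients to r; ≗-eval to Δx≈; topRow to leading)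
    Δy≈ : Δy F (eval F m (suc n) q) ≗ eval F m n (transpose r)
    Δy≈ (a , b) = begin
      eval F m (suc n) q (a , b) - eval F m (suc n) q (a , b - 1#)
        ≈⟨ +-cong (eval-transpose m (suc n) q a b) (-‿cong (eval-transpose m (suc n) q a (b - 1#))) ⟩
      Δx F (eval F (suc n) m (transpose q)) (b , a)  ≈⟨ Δx≈ (b , a) ⟩
      eval F n m r (b , a)                          ≈⟨ eval-transpose m n (transpose r) a b ⟨
      eval F m n (transpose r) (a , b)              ∎

  record IsPolynomial (m n : ℕ) (f : Fun) : Set (c ⊔ ℓ) where
    constructor polynomial
    field
      coefficients : Poly F
      ≗-eval       : f ≗ eval F m n coefficients

  Δx-vanishes : ∀ {n f} → IsPolynomial 0 n f → Δx F f ≗ λ _ → 0#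
  Δx-vanishes {n} (polynomial q f≈) p = trans (cong Δx-linear f≈ p) (Δx-eval₀ n q p)

  Δy-vanishes : ∀ {m f} → IsPolynomial m 0 f → Δy F f ≗ λ _ → 0#
  Δy-vanishes {m} (polynomial q f≈) p = trans (cong Δy-linear f≈ p) (Δy-eval₀ m q p)

  Δx-IsPolynomial : ∀ m n {f} → IsPolynomial m n f → IsPolynomial (ℕ.pred m) n (Δx F f)
  Δx-IsPolynomial zero n f∈Π =
    polynomial zeroPoly λ p → trans (Δx-vanishes f∈Π p) (sym (eval-zero 0 n (λ _ _ _ _ → refl) p))
  Δx-IsPolynomial (suc m) n (polynomial q f≈) =
    polynomial (HasTopRow.coefficients (Δx-eval m n q))
               λ p → trans (cong Δx-linear f≈ p) (HasTopRow.≗-eval (Δx-eval m n q) p)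

  Δy-IsPolynomial : ∀ m n {f} → IsPolynomial m n f → IsPolynomial m (ℕ.pred n) (Δy F f)
  Δy-IsPolynomial m zero f∈Π =
    polynomial zeroPoly λ p → trans (Δy-vanishes f∈Π p) (sym (eval-zero m 0 (λ _ _ _ _ → refl) p))
  Δy-IsPolynomial m (suc n) (polynomial q f≈) =
    polynomial (HasTopColumn.coefficients (Δy-eval m n q))
               λ p → trans (cong Δy-linear f≈ p) (HasTopColumn.≗-eval (Δy-eval m n q) p)

  iterΔx-IsPolynomial : ∀ i {m n f} → IsPolynomial m n f → IsPolynomial (m ∸ i) n (iter F i (Δx F) f)
  iterΔx-IsPolynomial zero    f∈Π = f∈Π
  iterΔx-IsPolynomial (suc i) {m} {n} {f} f∈Π =
    ≡.subst (λ d → IsPolynomial d n (iter F (suc i) (Δx F) f)) (ℕ.pred[m∸n]≡m∸[1+n] m i)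
            (Δx-IsPolynomial (m ∸ i) n (iterΔx-IsPolynomial i f∈Π))

  iterΔy-IsPolynomial : ∀ j {m n f} → IsPolynomial m n f → IsPolynomial m (n ∸ j) (iter F j (Δy F) f)
  iterΔy-IsPolynomial zero    f∈Π = f∈Π
  iterΔy-IsPolynomial (suc j) {m} {n} {f} f∈Π =
    ≡.subst (λ d → IsPolynomial m d (iter F (suc j) (Δy F) f)) (ℕ.pred[m∸n]≡m∸[1+n] n j)
            (Δy-IsPolynomial m (n ∸ j) (iterΔy-IsPolynomial j f∈Π))

  iterΔx-vanishes : ∀ i {m n f} → m < i → IsPolynomial m n f → iter F i (Δx F) f ≗ λ _ → 0#
  iterΔx-vanishes (suc i) {n = n} {f} (s≤s m≤i) f∈Π = Δx-vanishes
    (≡.subst (λ d → IsPolynomial d n (iter F i (Δx F) f)) (ℕ.m≤n⇒m∸n≡0 m≤i) (iterΔx-IsPolynomial i f∈Π))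

  iterΔy-vanishes : ∀ j {m n f} → n < j → IsPolynomial m n f → iter F j (Δy F) f ≗ λ _ → 0#
  iterΔy-vanishes (suc j) {m} {f = f} (s≤s n≤j) f∈Π = Δy-vanishes
    (≡.subst (λ d → IsPolynomial m d (iter F j (Δy F) f)) (ℕ.m≤n⇒m∸n≡0 n≤j) (iterΔy-IsPolynomial j f∈Π))

  Δ-IsPolynomial : ∀ i j {m n f} → IsPolynomial m n f → IsPolynomial (m ∸ i) (n ∸ j) (Δ[ i , j ] f)
  Δ-IsPolynomial i j f∈Π = iterΔx-IsPolynomial i (iterΔy-IsPolynomial j f∈Π)

  Δ-vanishes : ∀ i j {m n f} → m < i ⊎ n < j → IsPolynomial m n f → Δ[ i , j ] f ≗ λ _ → 0#
  Δ-vanishes i j (inj₁ m<i) f∈Π = iterΔx-vanishes i m<i (iterΔy-IsPolynomial j f∈Π)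
  Δ-vanishes i j (inj₂ n<j) f∈Π = vanishing (iter-linear i Δx-linear) (iterΔy-vanishes j n<j f∈Π)

  Δ-top-constant : ∀ {m n f} → IsPolynomial m n f → ∀ p p′ → Δ[ m , n ] f p ≈ Δ[ m , n ] f p′
  Δ-top-constant {m} {n} {f} f∈Π p p′ = trans (Δf≈ p) (sym (Δf≈ p′))
    where
    open IsPolynomial (≡.subst₂ (λ a b → IsPolynomial a b (Δ[ m , n ] f)) (ℕ.n∸n≡0 m) (ℕ.n∸n≡0 n)
                                (Δ-IsPolynomial m n f∈Π))
      renaming (≗-eval to Δf≈)

  ℕ→F-suc-cancel : CharZero F → ∀ k {x} → ℕ→F F (suc k) * x ≈ 0# → x ≈ 0#
  ℕ→F-suc-cancel char0 k {x} kx≈0 with inverse (ℕ→F F (suc k)) (char0 k)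
  ... | y , ky≈1 = begin
    x                        ≈⟨ *-identityˡ x ⟨
    1# * x                   ≈⟨ *-congʳ ky≈1 ⟨
    (ℕ→F F (suc k) * y) * x  ≈⟨ solve 3 (λ k y x → (k :* y) :* x := y :* (k :* x)) refl _ y x ⟩
    y * (ℕ→F F (suc k) * x)  ≈⟨ *-congˡ kx≈0 ⟩
    y * 0#                   ≈⟨ zeroʳ y ⟩
    0#                       ∎

  zeroData⇒zeroCoefficients₀ : CharZero F → ∀ n (w : ℕ → Point F) Q →
    (∀ j → j ≤ n → iter F j (Δy F) (eval F 0 n Q) (w j) ≈ 0#) → ∀ j → j ≤ n → Q 0 j ≈ 0#
  zeroData⇒zeroCoefficients₀ char0 zero    w Q zeroData .0 z≤n =
    trans (solve 1 (λ x → x := x :* (con (+ 1) :* con (+ 1))) refl (Q 0 0)) (zeroData 0 z≤n)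
  zeroData⇒zeroCoefficients₀ char0 (suc n) w Q zeroData = coefficient≈0
    where
    open HasTopColumn (Δy-eval 0 n Q) renaming (coefficients to Q′; ≗-eval to Δy≈; topColumn to leading)
    E = eval F 0 (suc n) Q

    Δy-zeroData : ∀ j → j ≤ n → iter F j (Δy F) (eval F 0 n Q′) (w (suc j)) ≈ 0#
    Δy-zeroData j j≤n = begin
      iter F j (Δy F) (eval F 0 n Q′) (w (suc j))  ≈⟨ cong (iter-linear j Δy-linear) Δy≈ (w (suc j)) ⟨
      iter F j (Δy F) (Δy F E) (w (suc j))         ≡⟨ ≡.cong-app (iter-suc j (Δy F) E) (w (suc j)) ⟩
      iter F (suc j) (Δy F) E (w (suc j))          ≈⟨ zeroData (suc j) (s≤s j≤n) ⟩
      0#                                           ∎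

    top : Q 0 (suc n) ≈ 0#
    top = ℕ→F-suc-cancel char0 n (trans (sym (leading 0))
            (zeroData⇒zeroCoefficients₀ char0 n (λ j → w (suc j)) Q′ Δy-zeroData n ℕ.≤-refl))

    lower-zeroData : ∀ j → j ≤ n → iter F j (Δy F) (eval F 0 n Q) (w j) ≈ 0#
    lower-zeroData j j≤n =
      trans (cong (iter-linear j Δy-linear) (λ p → sym (eval-dropColumn 0 n {Q} (λ { .0 z≤n → top }) p)) (w j))
            (zeroData j (ℕ.m≤n⇒m≤1+n j≤n))

    coefficient≈0 : ∀ j → j ≤ suc n → Q 0 j ≈ 0#
    coefficient≈0 j j≤1+n with ℕ.m≤n⇒m<n∨m≡n j≤1+n
    ... | inj₁ (s≤s j≤n) = zeroData⇒zeroCoefficients₀ char0 n w Q lower-zeroData j j≤n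
    ... | inj₂ ≡.refl    = top

  zeroData⇒zeroCoefficients : CharZero F → ∀ m n (W : NodeSet F) Q →
    (∀ i j → i ≤ m → j ≤ n → Δ[ i , j ] (eval F m n Q) (W i j) ≈ 0#) →
    ∀ i j → i ≤ m → j ≤ n → Q i j ≈ 0#
  zeroData⇒zeroCoefficients char0 zero    n W Q zeroData .0 j z≤n j≤n =
    zeroData⇒zeroCoefficients₀ char0 n (W 0) Q (λ j j≤n → zeroData 0 j z≤n j≤n) j j≤n
  zeroData⇒zeroCoefficients char0 (suc m) n W Q zeroData = coefficient≈0
    where
    open HasTopRow (Δx-eval m n Q) renaming (coefficients to Q′; ≗-eval to Δx≈; topRow to leading)
    E = eval F (suc m) n Q

    Δx-zeroData : ∀ i j → i ≤ m → j ≤ n → Δ[ i , j ] (eval F m n Q′) (W (suc i) j) ≈ 0#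
    Δx-zeroData i j i≤m j≤n = begin
      Δ[ i , j ] (eval F m n Q′) (W (suc i) j)  ≈⟨ cong (Δ-linear i j) Δx≈ (W (suc i) j) ⟨
      Δ[ i , j ] (Δx F E) (W (suc i) j)         ≈⟨ Δ-Δx i j E (W (suc i) j) ⟩
      Δ[ suc i , j ] E (W (suc i) j)            ≈⟨ zeroData (suc i) j (s≤s i≤m) j≤n ⟩
      0#                                        ∎

    top : ∀ j → j ≤ n → Q (suc m) j ≈ 0#
    top j j≤n = ℕ→F-suc-cancel char0 m (trans (sym (leading j))
                  (zeroData⇒zeroCoefficients char0 m n (λ i → W (suc i)) Q′ Δx-zeroData m j ℕ.≤-refl j≤n))

    lower-zeroData : ∀ i j → i ≤ m → j ≤ n → Δ[ i , j ] (eval F m n Q) (W i j) ≈ 0#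
    lower-zeroData i j i≤m j≤n =
      trans (cong (Δ-linear i j) (λ p → sym (eval-dropRow m n top p)) (W i j))
            (zeroData i j (ℕ.m≤n⇒m≤1+n i≤m) j≤n)

    coefficient≈0 : ∀ i j → i ≤ suc m → j ≤ n → Q i j ≈ 0#
    coefficient≈0 i j i≤1+m j≤n with ℕ.m≤n⇒m<n∨m≡n i≤1+m
    ... | inj₁ (s≤s i≤m) = zeroData⇒zeroCoefficients char0 m n W Q lower-zeroData i j i≤m j≤n
    ... | inj₂ ≡.refl    = top j j≤n

  rhs-diagonal : ∀ m n → rhs F m n m n ≡ ℕ→F F (m ! ℕ.* n !)
  rhs-diagonal m n with m ≟ m | n ≟ n
  ... | yes _  | yes _  = ≡.refl
  ... | yes _  | no n≢n = ⊥-elim (n≢n ≡.refl)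
  ... | no m≢m | _      = ⊥-elim (m≢m ≡.refl)

  rhs-offDiagonal : ∀ m n i j → ¬ (m ≡ i × n ≡ j) → rhs F m n i j ≡ 0#
  rhs-offDiagonal m n i j ≢ with m ≟ i | n ≟ j
  ... | yes m≡i | yes n≡j = ⊥-elim (≢ (m≡i , n≡j))
  ... | yes _   | no  _   = ≡.refl
  ... | no  _   | _       = ≡.refl

  replace-at : ∀ Z i0 j0 (z : Point F) → replace F Z i0 j0 z i0 j0 ≡ z
  replace-at Z i0 j0 z with i0 ≟ i0 | j0 ≟ j0
  ... | yes _    | yes _    = ≡.refl
  ... | yes _    | no j0≢j0 = ⊥-elim (j0≢j0 ≡.refl)
  ... | no i0≢i0 | _        = ⊥-elim (i0≢i0 ≡.refl)

  replace-elsewhere : ∀ Z i0 j0 (z : Point F) i j → ¬ (i ≡ i0 × j ≡ j0) → replace F Z i0 j0 z i j ≡ Z i j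
  replace-elsewhere Z i0 j0 z i j ≢ with i ≟ i0 | j ≟ j0
  ... | yes i≡i0 | yes j≡j0 = ⊥-elim (≢ (i≡i0 , j≡j0))
  ... | yes _    | no  _    = ≡.refl
  ... | no  _    | _        = ≡.refl

  ℕ→F≡· : ∀ n → ℕ→F F n ≡ n ·ᵤ 1#
  ℕ→F≡· zero    = ≡.refl
  ℕ→F≡· (suc n) = ≡.cong (λ x → 1# + x) (ℕ→F≡· n)

  ℕ→F-* : ∀ m n → ℕ→F F (m ℕ.* n) ≈ ℕ→F F m * ℕ→F F n
  ℕ→F-* m n rewrite ℕ→F≡· (m ℕ.* n) | ℕ→F≡· m | ℕ→F≡· n = ×1-homo-* m n

  rhs-shift-offDiagonal : ∀ {m n i0 j0} a b → ¬ (a ≡ m ∸ i0 × b ≡ n ∸ j0) →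
    rhs F m n (a ℕ.+ i0) (b ℕ.+ j0) ≈ ℕ→F F (Δ-scale m n i0 j0) * rhs F (m ∸ i0) (n ∸ j0) a b
  rhs-shift-offDiagonal {m} {n} {i0} {j0} a b ≢ = begin
    rhs F m n (a ℕ.+ i0) (b ℕ.+ j0)
      ≡⟨ rhs-offDiagonal m n _ _ (λ (m≡ , n≡) → ≢ (unshift a i0 m≡ , unshift b j0 n≡)) ⟩
    0#
      ≈⟨ zeroʳ _ ⟨
    s * 0#
      ≡⟨ ≡.cong (s *_) (rhs-offDiagonal _ _ a b (λ (m′≡a , n′≡b) → ≢ (≡.sym m′≡a , ≡.sym n′≡b))) ⟨
    s * rhs F (m ∸ i0) (n ∸ j0) a b ∎
    where
    s = ℕ→F F (Δ-scale m n i0 j0)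
    unshift : ∀ a i {m} → m ≡ a ℕ.+ i → a ≡ m ∸ i
    unshift a i m≡a+i = ≡.trans (≡.sym (ℕ.m+n∸n≡m a i)) (≡.cong (_∸ i) (≡.sym m≡a+i))

  rhs-shift : ∀ {m n i0 j0} a b → i0 ≤ m → j0 ≤ n →
    rhs F m n (a ℕ.+ i0) (b ℕ.+ j0) ≈ ℕ→F F (Δ-scale m n i0 j0) * rhs F (m ∸ i0) (n ∸ j0) a b
  rhs-shift {m} {n} {i0} {j0} a b i0≤m j0≤n with a ≟ m ∸ i0 | b ≟ n ∸ j0
  ... | yes ≡.refl | yes ≡.refl = begin
    rhs F m n (m ∸ i0 ℕ.+ i0) (n ∸ j0 ℕ.+ j0)
      ≡⟨ ≡.cong₂ (rhs F m n) (ℕ.m∸n+n≡m i0≤m) (ℕ.m∸n+n≡m j0≤n) ⟩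
    rhs F m n m n
      ≡⟨ rhs-diagonal m n ⟩
    ℕ→F F (m ! ℕ.* n !)
      ≡⟨ ≡.cong (ℕ→F F) (m!*n!≡Δ-scale*[m∸i]!*[n∸j]! i0≤m j0≤n) ⟩
    ℕ→F F (Δ-scale m n i0 j0 ℕ.* ((m ∸ i0) ! ℕ.* (n ∸ j0) !))
      ≈⟨ ℕ→F-* (Δ-scale m n i0 j0) _ ⟩
    ℕ→F F (Δ-scale m n i0 j0) * ℕ→F F ((m ∸ i0) ! ℕ.* (n ∸ j0) !)
      ≡⟨ ≡.cong (ℕ→F F (Δ-scale m n i0 j0) *_) (rhs-diagonal (m ∸ i0) (n ∸ j0)) ⟨
    ℕ→F F (Δ-scale m n i0 j0) * rhs F (m ∸ i0) (n ∸ j0) (m ∸ i0) (n ∸ j0) ∎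
  ... | no a≢m′ | _       = rhs-shift-offDiagonal {m} {n} {i0} {j0} a b (λ (a≡m′ , _) → a≢m′ a≡m′)
  ... | yes _   | no b≢n′ = rhs-shift-offDiagonal {m} {n} {i0} {j0} a b (λ (_ , b≡n′) → b≢n′ b≡n′)

  Δ-gTilde-shiftLD : CharZero F → ∀ {m n i0 j0 Z G H} → i0 ≤ m → j0 ≤ n →
    IsGTilde F m n Z G → IsGTilde F (m ∸ i0) (n ∸ j0) (shiftLD F i0 j0 Z) H →
    Δ[ i0 , j0 ] (eval F m n G) ≗ λ p → ℕ→F F (Δ-scale m n i0 j0) * eval F (m ∸ i0) (n ∸ j0) H p
  Δ-gTilde-shiftLD char0 {m} {n} {i0} {j0} {Z} {G} {H} i0≤m j0≤n (_ , G-data) (_ , H-data) p =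
    x∙y⁻¹≈ε⇒x≈y _ _ (begin
      ΔG p - s * eval F m′ n′ H p  ≈⟨ eval-D p ⟨
      eval F m′ n′ D p             ≈⟨ eval-zero m′ n′ (zeroData⇒zeroCoefficients char0 m′ n′ _ D D-zeroData) p ⟩
      0#                           ∎)
    where
    m′ = m ∸ i0
    n′ = n ∸ j0
    s  = ℕ→F F (Δ-scale m n i0 j0)
    ΔG = Δ[ i0 , j0 ] (eval F m n G)
    open IsPolynomial (Δ-IsPolynomial i0 j0 (polynomial {m} {n} G λ _ → refl))
      renaming (coefficients to R; ≗-eval to ΔG≈R)

    D : Poly F
    D a b = R a b - s * H a b

    eval-D : eval F m′ n′ D ≗ λ p → ΔG p - s * eval F m′ n′ H p
    eval-D p = trans (eval-combination m′ n′ s R H p) (+-congʳ (sym (ΔG≈R p)))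

    D-zeroData : ∀ a b → a ≤ m′ → b ≤ n′ → Δ[ a , b ] (eval F m′ n′ D) (Z (a ℕ.+ i0) (b ℕ.+ j0)) ≈ 0#
    D-zeroData a b a≤m′ b≤n′ = begin
      Δ[ a , b ] (eval F m′ n′ D) z                          ≈⟨ cong (Δ-linear a b) eval-D z ⟩
      Δ[ a , b ] (λ p → ΔG p - s * eval F m′ n′ H p) z       ≈⟨ combination (Δ-linear a b) s ΔG _ z ⟩
      Δ[ a , b ] ΔG z - s * Δ[ a , b ] (eval F m′ n′ H) z    ≈⟨ +-cong G-datum (-‿cong (*-congˡ (H-data a b a≤m′ b≤n′))) ⟩
      rhs F m n (a ℕ.+ i0) (b ℕ.+ j0) - s * rhs F m′ n′ a b  ≈⟨ +-congʳ (rhs-shift a b i0≤m j0≤n) ⟩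
      s * rhs F m′ n′ a b - s * rhs F m′ n′ a b              ≈⟨ -‿inverseʳ _ ⟩
      0#                                                     ∎
      where
      z = Z (a ℕ.+ i0) (b ℕ.+ j0)
      G-datum : Δ[ a , b ] ΔG z ≈ rhs F m n (a ℕ.+ i0) (b ℕ.+ j0)
      G-datum = trans (Δ-+ a b i0 j0 _ z)
                      (G-data _ _ (ℕ.m≤o∸n⇒m+n≤o a i0≤m a≤m′) (ℕ.m≤o∸n⇒m+n≤o b j0≤n b≤n′))

  gTilde-data-everywhere : ∀ {a b m n Z K} → a ≤ m → b ≤ n → IsGTilde F a b Z K →
    ∀ i j → Δ[ i , j ] (eval F m n K) (Z i j) ≈ rhs F a b i j
  gTilde-data-everywhere {a} {b} {m} {n} {Z} {K} a≤m b≤n (K∈Π , K-data) i j =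
    trans (cong (Δ-linear i j) (eval-InΠ m n K∈Π a≤m b≤n) (Z i j)) ([ inBox , outOfBox ]′ (inBox? i j a b))
    where
    inBox : i ≤ a × j ≤ b → Δ[ i , j ] (eval F a b K) (Z i j) ≈ rhs F a b i j
    inBox (i≤a , j≤b) = K-data i j i≤a j≤b
    outOfBox : a < i ⊎ b < j → Δ[ i , j ] (eval F a b K) (Z i j) ≈ rhs F a b i j
    outOfBox out = trans (Δ-vanishes i j out (polynomial K λ _ → refl) (Z i j))
      (sym (reflexive (rhs-offDiagonal a b i j λ (a≡i , b≡j) → [ ℕ.<-irrefl a≡i , ℕ.<-irrefl b≡j ]′ out)))

  gTilde-unique : CharZero F → ∀ {m n W P Q} → IsGTilde F m n W P → IsGTilde F m n W Q → ∀ i j → P i j ≈ Q i j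
  gTilde-unique char0 {m} {n} {W} {P} {Q} (P∈Π , P-data) (Q∈Π , Q-data) i j =
    [ inBox , outOfBox ]′ (inBox? i j m n)
    where
    D-zeroData : ∀ i j → i ≤ m → j ≤ n → Δ[ i , j ] (eval F m n (λ i j → P i j - Q i j)) (W i j) ≈ 0#
    D-zeroData i j i≤m j≤n = begin
      Δ[ i , j ] (eval F m n (λ i j → P i j - Q i j)) w               ≈⟨ cong (Δ-linear i j) (eval-- m n P Q) w ⟩
      Δ[ i , j ] (λ p → eval F m n P p - eval F m n Q p) w            ≈⟨ subtractive (Δ-linear i j) _ _ w ⟩
      Δ[ i , j ] (eval F m n P) w - Δ[ i , j ] (eval F m n Q) w      ≈⟨ +-cong (P-data i j i≤m j≤n)
                                                                                (-‿cong (Q-data i j i≤m j≤n)) ⟩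
      rhs F m n i j - rhs F m n i j                                  ≈⟨ -‿inverseʳ _ ⟩
      0#                                                             ∎
      where w = W i j
    inBox : i ≤ m × j ≤ n → P i j ≈ Q i j
    inBox (i≤m , j≤n) = x∙y⁻¹≈ε⇒x≈y _ _ (zeroData⇒zeroCoefficients char0 m n W _ D-zeroData i j i≤m j≤n)
    outOfBox : m < i ⊎ n < j → P i j ≈ Q i j
    outOfBox out = trans (P∈Π i j out) (sym (Q∈Π i j out))

  gTilde-replace : CharZero F → ∀ {Z m n i0 j0 z* G H K} → i0 ≤ m → j0 ≤ n → ¬ ((i0 , j0) ≡ (m , n)) →
    IsGTilde F m n Z G → IsGTilde F (m ∸ i0) (n ∸ j0) (shiftLD F i0 j0 Z) H → IsGTilde F i0 j0 Z K →
    let γ = ℕ→F F ((m C i0) ℕ.* (n C j0)) * eval F (m ∸ i0) (n ∸ j0) H z*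
    in IsGTilde F m n (replace F Z i0 j0 z*) (λ i j → G i j - γ * K i j)
  gTilde-replace char0 {Z} {m} {n} {i0} {j0} {z*} {G} {H} {K} i0≤m j0≤n ij0≢mn
                 G̃@(G∈Π , G-data) H̃ K̃@(K∈Π , _) = G-γK∈Π , G-γK-data
    where
    κ  = ℕ→F F ((m C i0) ℕ.* (n C j0))
    h  = eval F (m ∸ i0) (n ∸ j0) H z*
    γ  = κ * h
    Z* = replace F Z i0 j0 z*
    ΔG = λ i j → Δ[ i , j ] (eval F m n G)
    ΔK = λ i j → Δ[ i , j ] (eval F m n K)

    G-γK : Poly F
    G-γK i j = G i j - γ * K i j

    G-γK∈Π : InΠ F m n G-γK
    G-γK∈Π i j out = begin
      G i j - γ * K i j  ≈⟨ +-cong (G∈Π i j out) (-‿cong (*-congˡ (K∈Π i j out′))) ⟩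
      0# - γ * 0#        ≈⟨ solve 1 (λ x → con (+ 0) :- x :* con (+ 0) := con (+ 0)) refl γ ⟩
      0#                 ∎
      where out′ = Sum.map (ℕ.≤-<-trans i0≤m) (ℕ.≤-<-trans j0≤n) out

    ΔK-at-z* : ΔK i0 j0 z* ≈ ℕ→F F (i0 ! ℕ.* j0 !)
    ΔK-at-z* = begin
      ΔK i0 j0 z*            ≈⟨ Δ-top-constant (polynomial {i0} {j0} K (eval-InΠ m n K∈Π i0≤m j0≤n)) z* (Z i0 j0) ⟩
      ΔK i0 j0 (Z i0 j0)     ≈⟨ gTilde-data-everywhere i0≤m j0≤n K̃ i0 j0 ⟩
      rhs F i0 j0 i0 j0      ≡⟨ rhs-diagonal i0 j0 ⟩
      ℕ→F F (i0 ! ℕ.* j0 !)  ∎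

    Δ-G-γK : ∀ i j p → Δ[ i , j ] (eval F m n G-γK) p ≈ ΔG i j p - γ * ΔK i j p
    Δ-G-γK i j p = trans (cong (Δ-linear i j) (eval-combination m n γ G K) p) (combination (Δ-linear i j) γ _ _ p)

    G-γK-data : ∀ i j → i ≤ m → j ≤ n → Δ[ i , j ] (eval F m n G-γK) (Z* i j) ≈ rhs F m n i j
    G-γK-data i j i≤m j≤n = atOrAwayFromReplaced (i ≟ i0) (j ≟ j0)
      where
      awayFromReplaced : ¬ (i ≡ i0 × j ≡ j0) → Δ[ i , j ] (eval F m n G-γK) (Z* i j) ≈ rhs F m n i j
      awayFromReplaced ≢ = begin
        Δ[ i , j ] (eval F m n G-γK) (Z* i j)
          ≈⟨ Δ-G-γK i j (Z* i j) ⟩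
        ΔG i j (Z* i j) - γ * ΔK i j (Z* i j)
          ≡⟨ ≡.cong (λ z → ΔG i j z - γ * ΔK i j z) (replace-elsewhere Z i0 j0 z* i j ≢) ⟩
        ΔG i j (Z i j) - γ * ΔK i j (Z i j)
          ≈⟨ +-cong (G-data i j i≤m j≤n) (-‿cong (*-congˡ (gTilde-data-everywhere i0≤m j0≤n K̃ i j))) ⟩
        rhs F m n i j - γ * rhs F i0 j0 i j
          ≡⟨ ≡.cong (λ r → rhs F m n i j - γ * r)
                    (rhs-offDiagonal i0 j0 i j λ (i0≡i , j0≡j) → ≢ (≡.sym i0≡i , ≡.sym j0≡j)) ⟩
        rhs F m n i j - γ * 0#
          ≈⟨ solve 2 (λ r x → r :- x :* con (+ 0) := r) refl _ γ ⟩
        rhs F m n i j ∎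

      atOrAwayFromReplaced : Dec (i ≡ i0) → Dec (j ≡ j0) → Δ[ i , j ] (eval F m n G-γK) (Z* i j) ≈ rhs F m n i j
      atOrAwayFromReplaced (yes ≡.refl) (yes ≡.refl) = begin
        Δ[ i0 , j0 ] (eval F m n G-γK) (Z* i0 j0)
          ≈⟨ Δ-G-γK i0 j0 (Z* i0 j0) ⟩
        ΔG i0 j0 (Z* i0 j0) - γ * ΔK i0 j0 (Z* i0 j0)
          ≡⟨ ≡.cong (λ z → ΔG i0 j0 z - γ * ΔK i0 j0 z) (replace-at Z i0 j0 z*) ⟩
        ΔG i0 j0 z* - γ * ΔK i0 j0 z*
          ≈⟨ +-cong (Δ-gTilde-shiftLD char0 i0≤m j0≤n G̃ H̃ z*) (-‿cong (*-congˡ ΔK-at-z*)) ⟩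
        ℕ→F F (Δ-scale m n i0 j0) * h - γ * ℕ→F F (i0 ! ℕ.* j0 !)
          ≈⟨ +-congʳ (*-congʳ (ℕ→F-* ((m C i0) ℕ.* (n C j0)) (i0 ! ℕ.* j0 !))) ⟩
        (κ * ℕ→F F (i0 ! ℕ.* j0 !)) * h - (κ * h) * ℕ→F F (i0 ! ℕ.* j0 !)
          ≈⟨ solve 3 (λ k f h → (k :* f) :* h :- (k :* h) :* f := con (+ 0)) refl κ _ h ⟩
        0#
          ≡⟨ rhs-offDiagonal m n i0 j0 (λ (m≡i0 , n≡j0) → ij0≢mn (≡.cong₂ _,_ (≡.sym m≡i0) (≡.sym n≡j0))) ⟨
        rhs F m n i0 j0 ∎
      atOrAwayFromReplaced (yes _)    (no j≢j0) = awayFromReplaced λ (_ , j≡j0) → j≢j0 j≡j0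
      atOrAwayFromReplaced (no i≢i0) _          = awayFromReplaced λ (i≡i0 , _) → i≢i0 i≡i0

open import Data.Nat using (ℕ; _≤_; _∸_; _*_)
open import Data.Nat.Combinatorics using (_C_)
open import Data.Product using (_×_; _,_)
open import Relation.Nullary using (¬_)
open import Relation.Binary.PropositionalEquality using (_≡_)

theorem8 : ∀ {c ℓ : Level} (F : Field c ℓ) → CharZero F →
  (Z : NodeSet F) (m n i0 j0 : ℕ) → i0 ≤ m → j0 ≤ n → ¬ ((i0 , j0) ≡ (m , n)) →
  (z* : Point F) →
  (G G* H K : Poly F) →
  IsGTilde F m n Z G →
  IsGTilde F m n (replace F Z i0 j0 z*) G* →
  IsGTilde F (m ∸ i0) (n ∸ j0) (shiftLD F i0 j0 Z) H →
  IsGTilde F i0 j0 Z K →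
  ∀ i j → Field._≈_ F (G* i j)
    (Field._-_ F (G i j)
      (Field._*_ F
        (Field._*_ F (ℕ→F F ((m C i0) * (n C j0))) (eval F (m ∸ i0) (n ∸ j0) H z*))
        (K i j)))
theorem8 F char0 Z m n i0 j0 i0≤m j0≤n ij0≢mn z* G G* H K G̃ G̃* H̃ K̃ =
  gTilde-unique char0 G̃* (gTilde-replace char0 i0≤m j0≤n ij0≢mn G̃ H̃ K̃)
  where open Interpolation F
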